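{- Let $\beta=1$. For any indexed forest $F$ and any $i\ge1$, the operator $\widehat{T}_F\circ R_i$ on $\mathbb{Z}[x_1,x_2,\ldots]$ can be written as a finite $\mathbb{Z}$-linear combination of operators of the form $R_{i_1}\circ\cdots\circ R_{i_t}\circ\widehat{T}_G$ with $t\ge0$, positive integers $i_1,\ldots,i_t$, and indexed forests $G$. In particular, $\mathrm{ct}\circ\widehat{T}_F\circ R_i$ is a finite $\mathbb{Z}$-linear combination of operators $\mathrm{ct}\circ\widehat{T}_G$.
   Context: $\mathrm{ct}$ is the constant term. Operators on $\mathbb{Z}[x_1,x_2,\ldots]$: $R_i f=f(x_1,\ldots,x_{i-1},0,x_i,\ldots)$, $T_i f=\frac1{x_i}(R_{i+1}f-R_if)$, $T^L_i=T_i$, $T^R_i f=(1+x_i)T_if$. Indexed forests: a sequence of full binary trees (ordered left/right children), all but finitely many trivial (single node); leaves read left to right are labeled $1,2,3,\ldots$; $\emptyset$ is the forest of trivial trees. $\mathrm{QDes}(F)$ is the set of $i$ such that leaves $i,i+1$ are the left and right children of a common internal node $u$; $F/i$ is obtained by deleting these two leaves (so $u$ becomes a leaf) and relabeling leaves consecutively. Grove extractor: $\widehat{T}_\emptyset=\mathrm{id}$ and, for $F\ne\emptyset$ and any $i\in\mathrm{QDes}(F)$ with terminal node $u$, $\widehat{T}_F=\widehat{T}_{F/i}\circ T^R_i$ if $u$ is the right child of its parent, and $\widehat{T}_F=\widehat{T}_{F/i}\circ T^L_i$ otherwise; this is independent of the choice of $i$. -}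

module Defs where

open import Data.Nat as ℕ using (ℕ; zero; suc; _≡ᵇ_; _∸_)
open import Data.Integer as ℤ using (ℤ; +_; -_)
open import Data.Bool using (Bool; true; false; _∧_; if_then_else_)
open import Data.List using (List; []; _∷_; _++_; map; concatMap; foldr)
open import Data.Maybe using (Maybe; just; nothing)
open import Data.Product using (_×_; _,_)
open import Function using (_∘_; id)
open import Relation.Binary.PropositionalEquality using (_≡_)

-- Polynomials in ℤ[x₁,x₂,…]
-- A monomial x₁^a₁ x₂^a₂ ⋯ is its exponent list [a₁, a₂, …]
-- (missing trailing entries are 0).  A polynomial is a finite formal
-- ℤ-combination of monomials; two polynomials are equal (≈) iff all
-- their coefficients agree.

Monomial : Set
Monomial = List ℕ

Poly : Set
Poly = List (ℤ × Monomial)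

eqMon : Monomial → Monomial → Bool
eqMon [] [] = true
eqMon [] (b ∷ bs) = (b ≡ᵇ 0) ∧ eqMon [] bs
eqMon (a ∷ as) [] = (a ≡ᵇ 0) ∧ eqMon as []
eqMon (a ∷ as) (b ∷ bs) = (a ≡ᵇ b) ∧ eqMon as bs

coeff : Poly → Monomial → ℤ
coeff [] m = + 0
coeff ((c , a) ∷ p) m = (if eqMon a m then c else + 0) ℤ.+ coeff p m

infix 4 _≈_
_≈_ : Poly → Poly → Set
p ≈ q = ∀ m → coeff p m ≡ coeff q m

zeroP : Poly
zeroP = []

_⊕_ : Poly → Poly → Poly
p ⊕ q = p ++ q

scale : ℤ → Poly → Poly
scale c = map (λ { (d , a) → (c ℤ.* d , a) })

_⊖_ : Poly → Poly → Poly
p ⊖ q = p ⊕ scale (- (+ 1)) q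

ct : Poly → ℤ
ct p = coeff p []

-- helpers on exponent lists (0-based positions)
get : Monomial → ℕ → ℕ
get [] _ = 0
get (a ∷ as) zero = a
get (a ∷ as) (suc j) = get as j

del : ℕ → Monomial → Monomial
del _ [] = []
del zero (a ∷ as) = as
del (suc j) (a ∷ as) = a ∷ del j as

inc : ℕ → Monomial → Monomial
inc zero [] = 1 ∷ []
inc (suc j) [] = 0 ∷ inc j []
inc zero (a ∷ as) = suc a ∷ as
inc (suc j) (a ∷ as) = a ∷ inc j as

dec : ℕ → Monomial → Monomial
dec _ [] = []
dec zero (a ∷ as) = a ∸ 1 ∷ as
dec (suc j) (a ∷ as) = a ∷ dec j as

-- Operators (variable indices are 1-based, as in the paper)

-- R_i f = f(x₁,…,x_{i-1},0,x_i,x_{i+1},…)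
R : ℕ → Poly → Poly
R i = concatMap λ { (c , a) →
        if get a (i ∸ 1) ≡ᵇ 0 then (c , del (i ∸ 1) a) ∷ [] else [] }

-- exact division by x_i: keeps the terms divisible by x_i and lowers
-- their exponent (used only on polynomials divisible by x_i, after
-- collecting terms)
divX : ℕ → Poly → Poly
divX i = concatMap λ { (c , a) →
           if get a (i ∸ 1) ≡ᵇ 0 then [] else (c , dec (i ∸ 1) a) ∷ [] }

mulX : ℕ → Poly → Poly
mulX i = map λ { (c , a) → (c , inc (i ∸ 1) a) }

T : ℕ → Poly → Poly
T i f = divX i (R (suc i) f ⊖ R i f)

TL : ℕ → Poly → Poly
TL = T

TR : ℕ → Poly → Poly
TR i f = T i f ⊕ mulX i (T i f)

data Tree : Set where
  leaf : Tree
  node : Tree → Tree → Tree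

-- An indexed forest: the list of its first trees; all later trees are
-- trivial (single nodes).  Leaves are labelled 1,2,3,… left to right.
Forest : Set
Forest = List Tree

emptyForest : Forest
emptyForest = []

leaves : Tree → ℕ
leaves leaf = 1
leaves (node l r) = leaves l ℕ.+ leaves r

internal : Tree → ℕ
internal leaf = 0
internal (node l r) = suc (internal l ℕ.+ internal r)

internalF : Forest → ℕ
internalF = foldr (λ t n → internal t ℕ.+ n) 0

-- Leftmost element of QDes inside a tree.  The Bool argument says
-- whether the tree is the right child of its parent.  Returns
-- (0-based offset of the left leaf of the cherry inside the tree,
--  whether the cherry node u is a right child, the contracted tree).
cherry : Bool → Tree → Maybe (ℕ × Bool × Tree)
cherry b leaf = nothing
cherry b (node leaf leaf) = just (0 , b , leaf)
cherry b (node l r) with cherry false l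
... | just (k , s , l') = just (k , s , node l' r)
... | nothing with cherry true r
...   | just (k , s , r') = just (leaves l ℕ.+ k , s , node l r')
...   | nothing = nothing

-- Leftmost i ∈ QDes(F): returns (i, whether u is a right child, F/i).
-- Roots are not right children.
cherryF : ℕ → Forest → Maybe (ℕ × Bool × Forest)
cherryF off [] = nothing
cherryF off (t ∷ ts) with cherry false t
... | just (k , s , t') = just (suc (off ℕ.+ k) , s , t' ∷ ts)
... | nothing with cherryF (off ℕ.+ leaves t) ts
...   | just (i , s , ts') = just (i , s , t ∷ ts')
...   | nothing = nothing

-- Grove extractor, computed with the leftmost choice of i ∈ QDes(F)
-- (the result is independent of the choice).  The fuel is the number
-- of internal nodes, which drops by one at each step.
groveFuel : ℕ → Forest → Poly → Poly
groveFuel zero F = id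
groveFuel (suc n) F with cherryF 0 F
... | nothing = id
... | just (i , true , F') = groveFuel n F' ∘ TR i
... | just (i , false , F') = groveFuel n F' ∘ TL i

That : Forest → Poly → Poly
That F = groveFuel (internalF F) F

Rs : List ℕ → Poly → Poly
Rs = foldr (λ j g → R j ∘ g) id

linComb : List (ℤ × List ℕ × Forest) → Poly → Poly
linComb [] f = zeroP
linComb ((c , is , G) ∷ L) f = scale c (Rs is (That G f)) ⊕ linComb L f

ctComb : List (ℤ × Forest) → Poly → ℤ
ctComb [] f = + 0
ctComb ((c , G) ∷ L) f = c ℤ.* ct (That G f) ℤ.+ ctComb L f

-- The operators act on coefficients through shifts of exponent vectors: (R_j f)[m] is the
-- coefficient of f at m with a zero exponent inserted in position j, and (T^L_i f)[m] and
-- (T^R_i f)[m] are signed sums of four such coefficients.  This yields the exchange rules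
--   T_i R_j = R_{j-1} T_i  (j ≥ i+2),    T_i R_{i+1} = R_i T_{i+1} + R_{i+1} T_i,
--   T_i R_j = R_j T_{i+1}  (j ≤ i),      T_i T_k = T_{k-1} T_i  (k ≥ i+2),
--   T^R_i = T^L_i + R_{i+1} − R_i,
-- where each T may be T^L or T^R.  Writing T̂_F = T̂_{F/i} ∘ T_i for the leftmost cherry i of F,
-- the first three rules turn T̂_F ∘ R_j into a combination of operators T̂_{F/i} ∘ R_{j′} ∘ T_k.
-- By induction on the number of internal nodes, T̂_{F/i} ∘ R_{j′} is a combination of operators
-- R_{i₁} ∘ ⋯ ∘ R_{i_t} ∘ T̂_G with G no larger than F/i, and T̂_G ∘ T_k is the grove extractor of
-- G with leaf k split into a cherry (the fourth rule makes the position of that cherry among the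
-- others irrelevant), up to a multiple of T̂_G ∘ (R_{k+1} − R_k) from the last rule, which the
-- induction hypothesis for G expands again.  Since ct ∘ R_j = ct, the second claim follows.

module Submission where

open import Defs
open import Algebra.Bundles using (CommutativeMonoid)
open import Data.Bool using (Bool; true; false; not; _∧_; if_then_else_)
open import Data.Bool.Properties using (∧-zeroʳ; ∧-commutativeMonoid; T-≡)
open import Data.Integer as ℤ using (ℤ; +_; -_; _+_; _-_; _*_)
import Data.Integer.Properties as ℤ
open import Data.Integer.Tactic.RingSolver using (solve-∀)
open import Data.List using (List; []; _∷_; _++_; map)
import Data.List.Properties as List
open import Data.List.Relation.Unary.All as All using (All; []; _∷_)
import Data.List.Relation.Unary.All.Properties as All
open import Data.Maybe as Maybe using (Maybe; just; nothing)
open import Data.Nat as ℕ using (ℕ; zero; suc; _≡ᵇ_; _∸_; _≤_; _<_; z≤n; s≤s)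
open import Data.Nat.Induction using (<-wellFounded)
open import Induction.WellFounded using (Acc; acc)
import Data.Nat.Properties as ℕ
open import Data.Product as Product using (Σ; _×_; _,_; proj₁; proj₂)
open import Data.Sum as Sum using (_⊎_; inj₁; inj₂; [_,_]′)
open import Function using (_∘_; case_of_)
open import Function.Bundles using (Equivalence)
open import Relation.Binary.PropositionalEquality
open import Relation.Nullary using (yes; no; contradiction)
open import Level using (0ℓ)
open import Relation.Binary.Bundles using (Setoid)
open import Relation.Binary.Definitions using (Tri; tri<; tri≈; tri>)
import Relation.Binary.Reasoning.Setoid
open import Algebra.Properties.CommutativeSemigroup
  (CommutativeMonoid.commutativeSemigroup ∧-commutativeMonoid) using (x∙yz≈y∙xz)

-- Inserts a zero exponent at the 0-based position j; R_{j+1} acts on coefficients by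
-- precomposition with ins j (coeff-R).
ins : ℕ → Monomial → Monomial
ins zero    m       = 0 ∷ m
ins (suc j) []      = 0 ∷ ins j []
ins (suc j) (a ∷ m) = a ∷ ins j m

coeff-++ : ∀ p q m → coeff (p ++ q) m ≡ coeff p m + coeff q m
coeff-++ []            q m = sym (ℤ.+-identityˡ _)
coeff-++ ((c , a) ∷ p) q m =
  trans (cong (_+_ cₐ) (coeff-++ p q m)) (sym (ℤ.+-assoc cₐ (coeff p m) (coeff q m)))
  where cₐ = if eqMon a m then c else + 0

coeff-scale : ∀ c p m → coeff (scale c p) m ≡ c * coeff p m
coeff-scale c []            m = sym (ℤ.*-zeroʳ c)
coeff-scale c ((d , a) ∷ p) m with eqMon a m
... | true  = trans (cong (_+_ (c * d)) (coeff-scale c p m)) (sym (ℤ.*-distribˡ-+ c d _))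
... | false = trans (cong₂ _+_ (sym (ℤ.*-zeroʳ c)) (coeff-scale c p m))
                    (sym (ℤ.*-distribˡ-+ c (+ 0) _))

coeff-⊖ : ∀ p q m → coeff (p ⊖ q) m ≡ coeff p m - coeff q m
coeff-⊖ p q m =
  trans (coeff-++ p _ m) (cong (_+_ (coeff p m)) (trans (coeff-scale (- + 1) q m) (ℤ.-1*i≡-i (coeff q m))))

≡ᵇ-sym : ∀ x y → (x ≡ᵇ y) ≡ (y ≡ᵇ x)
≡ᵇ-sym zero    zero    = refl
≡ᵇ-sym zero    (suc y) = refl
≡ᵇ-sym (suc x) zero    = refl
≡ᵇ-sym (suc x) (suc y) = ≡ᵇ-sym x y

eqMon-sym : ∀ a b → eqMon a b ≡ eqMon b a
eqMon-sym []      []      = refl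
eqMon-sym []      (y ∷ b) = cong (_∧_ _) (eqMon-sym [] b)
eqMon-sym (x ∷ a) []      = cong (_∧_ _) (eqMon-sym a [])
eqMon-sym (x ∷ a) (y ∷ b) = cong₂ _∧_ (≡ᵇ-sym x y) (eqMon-sym a b)

eqMon-ins : ∀ j a m → eqMon a (ins j m) ≡ (get a j ≡ᵇ 0) ∧ eqMon (del j a) m
eqMon-ins zero    []      m       = refl
eqMon-ins zero    (x ∷ a) m       = refl
eqMon-ins (suc j) []      []      = eqMon-ins j [] []
eqMon-ins (suc j) []      (y ∷ m) = cong (_∧_ (y ≡ᵇ 0)) (eqMon-ins j [] m)
eqMon-ins (suc j) (x ∷ a) []      =
  trans (cong (_∧_ _) (eqMon-ins j a [])) (x∙yz≈y∙xz (x ≡ᵇ 0) (get a j ≡ᵇ 0) (eqMon (del j a) []))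
eqMon-ins (suc j) (x ∷ a) (y ∷ m) =
  trans (cong (_∧_ _) (eqMon-ins j a m)) (x∙yz≈y∙xz (x ≡ᵇ y) (get a j ≡ᵇ 0) (eqMon (del j a) m))

eqMon-inc : ∀ j a m → eqMon a (inc j m) ≡ not (get a j ≡ᵇ 0) ∧ eqMon (dec j a) m
eqMon-inc zero    []            []      = refl
eqMon-inc zero    []            (y ∷ m) = refl
eqMon-inc zero    (zero ∷ a)    []      = refl
eqMon-inc zero    (zero ∷ a)    (y ∷ m) = refl
eqMon-inc zero    (suc x ∷ a)   []      = refl
eqMon-inc zero    (suc x ∷ a)   (y ∷ m) = refl
eqMon-inc (suc j) []            []      = eqMon-inc j [] []
eqMon-inc (suc j) []            (y ∷ m) = trans (cong (_∧_ _) (eqMon-inc j [] m)) (∧-zeroʳ (y ≡ᵇ 0))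
eqMon-inc (suc j) (x ∷ a)       []      =
  trans (cong (_∧_ _) (eqMon-inc j a [])) (x∙yz≈y∙xz (x ≡ᵇ 0) (not (get a j ≡ᵇ 0)) (eqMon (dec j a) []))
eqMon-inc (suc j) (x ∷ a)       (y ∷ m) =
  trans (cong (_∧_ _) (eqMon-inc j a m)) (x∙yz≈y∙xz (x ≡ᵇ y) (not (get a j ≡ᵇ 0)) (eqMon (dec j a) m))

eqMon-inc′ : ∀ j a m → eqMon (inc j a) m ≡ not (get m j ≡ᵇ 0) ∧ eqMon a (dec j m)
eqMon-inc′ j a m = trans (eqMon-sym (inc j a) m)
                         (trans (eqMon-inc j m a) (cong (_∧_ _) (eqMon-sym (dec j m) a)))

eqMon-zeros : ∀ k a → eqMon a (ins k []) ≡ eqMon a []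
eqMon-zeros zero    []      = refl
eqMon-zeros zero    (x ∷ a) = refl
eqMon-zeros (suc k) []      = eqMon-zeros k []
eqMon-zeros (suc k) (x ∷ a) = cong (_∧_ (x ≡ᵇ 0)) (eqMon-zeros k a)

eqMon-ins-zero : ∀ j m → get m j ≡ 0 → ∀ x → eqMon x (ins (suc j) m) ≡ eqMon x (ins j m)
eqMon-ins-zero j       []      _  x       = trans (eqMon-zeros (suc j) x) (sym (eqMon-zeros j x))
eqMon-ins-zero zero    (a ∷ m) refl x     = refl
eqMon-ins-zero (suc j) (a ∷ m) mⱼ≡0 []      = cong (_∧_ (a ≡ᵇ 0)) (eqMon-ins-zero j m mⱼ≡0 [])
eqMon-ins-zero (suc j) (a ∷ m) mⱼ≡0 (y ∷ x) = cong (_∧_ (y ≡ᵇ a)) (eqMon-ins-zero j m mⱼ≡0 x)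

coeff-congʳ : ∀ {a b} → (∀ x → eqMon x a ≡ eqMon x b) → ∀ p → coeff p a ≡ coeff p b
coeff-congʳ a∼b []            = refl
coeff-congʳ a∼b ((c , x) ∷ p) =
  cong₂ _+_ (cong (λ e → if e then c else + 0) (a∼b x)) (coeff-congʳ a∼b p)

coeff-R : ∀ i p m → coeff (R i p) m ≡ coeff p (ins (i ∸ 1) m)
coeff-R i []            m = refl
coeff-R i ((c , a) ∷ p) m rewrite eqMon-ins (i ∸ 1) a m with get a (i ∸ 1) ≡ᵇ 0
... | true  = cong (_+_ (if eqMon (del (i ∸ 1) a) m then c else + 0)) (coeff-R i p m)
... | false = trans (coeff-R i p m) (sym (ℤ.+-identityˡ _))

coeff-divX : ∀ i p m → coeff (divX i p) m ≡ coeff p (inc (i ∸ 1) m)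
coeff-divX i []            m = refl
coeff-divX i ((c , a) ∷ p) m rewrite eqMon-inc (i ∸ 1) a m with get a (i ∸ 1) ≡ᵇ 0
... | true  = trans (coeff-divX i p m) (sym (ℤ.+-identityˡ _))
... | false = cong (_+_ (if eqMon (dec (i ∸ 1) a) m then c else + 0)) (coeff-divX i p m)

coeff-mulX : ∀ i p m →
  coeff (mulX i p) m ≡ (if get m (i ∸ 1) ≡ᵇ 0 then + 0 else coeff p (dec (i ∸ 1) m))
coeff-mulX i []            m with get m (i ∸ 1) ≡ᵇ 0
... | true  = refl
... | false = refl
coeff-mulX i ((c , a) ∷ p) m rewrite eqMon-inc′ (i ∸ 1) a m | coeff-mulX i p m
  with get m (i ∸ 1) ≡ᵇ 0
... | true  = refl
... | false = refl

coeff-ins-zero : ∀ i m → get m (i ∸ 1) ≡ 0 → ∀ p → coeff p (ins i m) ≡ coeff p (ins (i ∸ 1) m)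
coeff-ins-zero zero    m mᵢ≡0 p = refl
coeff-ins-zero (suc j) m mᵢ≡0 p = coeff-congʳ (eqMon-ins-zero j m mᵢ≡0) p

inc-dec : ∀ j m → (get m j ≡ᵇ 0) ≡ false → inc j (dec j m) ≡ m
inc-dec zero    (suc x ∷ m) _    = refl
inc-dec (suc j) (x ∷ m)     mⱼ≢0 = cong (x ∷_) (inc-dec j m mⱼ≢0)

ins-ins : ∀ {i j} → j ≤ i → ∀ m → ins (suc i) (ins j m) ≡ ins j (ins i m)
ins-ins {i}     {zero}  z≤n       m       = refl
ins-ins {suc i} {suc j} (s≤s j≤i) []      = cong (0 ∷_) (ins-ins j≤i [])
ins-ins {suc i} {suc j} (s≤s j≤i) (a ∷ m) = cong (a ∷_) (ins-ins j≤i m)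

ins-inc-> : ∀ {i j} → j < i → ∀ m → ins i (inc j m) ≡ inc j (ins i m)
ins-inc-> {suc i} {zero}  (s≤s z≤n)  []      = refl
ins-inc-> {suc i} {zero}  (s≤s z≤n)  (a ∷ m) = refl
ins-inc-> {suc i} {suc j} (s≤s j<i)  []      = cong (0 ∷_) (ins-inc-> j<i [])
ins-inc-> {suc i} {suc j} (s≤s j<i)  (a ∷ m) = cong (a ∷_) (ins-inc-> j<i m)

ins-inc-≤ : ∀ {i j} → i ≤ j → ∀ m → ins i (inc j m) ≡ inc (suc j) (ins i m)
ins-inc-≤ {zero}  {j}     z≤n       m       = refl
ins-inc-≤ {suc i} {suc j} (s≤s i≤j) []      = cong (0 ∷_) (ins-inc-≤ i≤j [])
ins-inc-≤ {suc i} {suc j} (s≤s i≤j) (a ∷ m) = cong (a ∷_) (ins-inc-≤ i≤j m)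

inc-inc : ∀ i j m → inc i (inc j m) ≡ inc j (inc i m)
inc-inc zero    zero    m       = refl
inc-inc zero    (suc j) []      = refl
inc-inc zero    (suc j) (a ∷ m) = refl
inc-inc (suc i) zero    []      = refl
inc-inc (suc i) zero    (a ∷ m) = refl
inc-inc (suc i) (suc j) []      = cong (0 ∷_) (inc-inc i j [])
inc-inc (suc i) (suc j) (a ∷ m) = cong (a ∷_) (inc-inc i j m)

χ : Bool → ℤ
χ true  = + 1
χ false = + 0

-- The flag is that of cherry: whether the node of the cherry is a right child.
Tˢ : Bool → ℕ → Poly → Poly
Tˢ true  = TR
Tˢ false = TL

Δ : ℤ → (Bool → Bool → ℤ) → ℤ
Δ σ x = x true true - x true false + σ * (x false true - x false false)

Δ-cong : ∀ σ {x y : Bool → Bool → ℤ} → (∀ r b → x r b ≡ y r b) → Δ σ x ≡ Δ σ y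
Δ-cong σ x≗y = cong₂ _+_ (cong₂ _-_ (x≗y true true) (x≗y true false))
                         (cong (σ *_) (cong₂ _-_ (x≗y false true) (x≗y false false)))

Δ-zero : ∀ x → Δ (+ 0) x ≡ x true true - x true false
Δ-zero x = lemma (x true true) (x true false) (x false true) (x false false)
  where
  lemma : ∀ a b c d → a - b + + 0 * (c - d) ≡ a - b
  lemma = solve-∀

Δ-one : ∀ x → Δ (+ 1) x ≡ x true true - x true false + (x false true - x false false)
Δ-one x = lemma (x true true) (x true false) (x false true) (x false false)
  where
  lemma : ∀ a b c d → a - b + + 1 * (c - d) ≡ a - b + (c - d)
  lemma = solve-∀

Δ-additive : ∀ σ x y → Δ σ (λ r b → x r b + y r b) ≡ Δ σ x + Δ σ y
Δ-additive σ x y = lemma σ (x true true) (x true false) (x false true) (x false false)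
                           (y true true) (y true false) (y false true) (y false false)
  where
  lemma : ∀ σ a b c d a′ b′ c′ d′ →
    (a + a′) - (b + b′) + σ * ((c + c′) - (d + d′)) ≡ (a - b + σ * (c - d)) + (a′ - b′ + σ * (c′ - d′))
  lemma = solve-∀

Δ-homogeneous : ∀ σ k x → Δ σ (λ r b → k * x r b) ≡ k * Δ σ x
Δ-homogeneous σ k x = lemma σ k (x true true) (x true false) (x false true) (x false false)
  where
  lemma : ∀ σ k a b c d → k * a - k * b + σ * (k * c - k * d) ≡ k * (a - b + σ * (c - d))
  lemma = solve-∀

grid : ℤ → ℤ → ℤ → ℤ → Bool → Bool → ℤ
grid a b c d true  true  = a
grid a b c d true  false = b
grid a b c d false true  = c
grid a b c d false false = d

Δ-telescope : ∀ σ x k k′ →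
  Δ σ x ≡ Δ σ (grid k (x true false) k′ (x false false)) + Δ σ (grid (x true true) k (x false true) k′)
Δ-telescope σ x k k′ = lemma σ (x true true) (x true false) (x false true) (x false false) k k′
  where
  lemma : ∀ σ a b c d k k′ → a - b + σ * (c - d) ≡ (k - b + σ * (k′ - d)) + (a - k + σ * (c - k′))
  lemma = solve-∀

Δ-change : ∀ σ σ′ x → Δ σ x ≡ Δ σ′ x + (σ - σ′) * (x false true - x false false)
Δ-change σ σ′ x = lemma σ σ′ (x true true) (x true false) (x false true) (x false false)
  where
  lemma : ∀ σ σ′ a b c d → a - b + σ * (c - d) ≡ (a - b + σ′ * (c - d)) + (σ - σ′) * (c - d)
  lemma = solve-∀

-- Δ is bilinear, so differencing along two independent pairs of directions commutes.
Δ-swap : ∀ σ τ (x : Bool → Bool → Bool → Bool → ℤ) →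
         Δ σ (λ r b → Δ τ (x r b)) ≡ Δ τ (λ r′ b′ → Δ σ (λ r b → x r b r′ b′))
Δ-swap σ τ x = lemma σ τ
  (x true true true true)   (x true true true false)   (x true true false true)   (x true true false false)
  (x true false true true)  (x true false true false)  (x true false false true)  (x true false false false)
  (x false true true true)  (x false true true false)  (x false true false true)  (x false true false false)
  (x false false true true) (x false false true false) (x false false false true) (x false false false false)
  where
  lemma : ∀ σ τ a₁ a₂ a₃ a₄ b₁ b₂ b₃ b₄ c₁ c₂ c₃ c₄ d₁ d₂ d₃ d₄ →
    (a₁ - a₂ + τ * (a₃ - a₄)) - (b₁ - b₂ + τ * (b₃ - b₄))
      + σ * ((c₁ - c₂ + τ * (c₃ - c₄)) - (d₁ - d₂ + τ * (d₃ - d₄)))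
    ≡ (a₁ - b₁ + σ * (c₁ - d₁)) - (a₂ - b₂ + σ * (c₂ - d₂))
      + τ * ((a₃ - b₃ + σ * (c₃ - d₃)) - (a₄ - b₄ + σ * (c₄ - d₄)))
  lemma = solve-∀

-- For the 1-based index i, (T_i f)[m] = f[probe true true i m] − f[probe true false i m]:
-- division by x_i raises the exponent of x_i in m, then R_{i+1} and R_i insert a zero exponent
-- at positions i+1 and i.  The extra term x_i T_i f = R_{i+1} f − R_i f of T^R_i is the same
-- difference without the raise.
probe : Bool → Bool → ℕ → Monomial → Monomial
probe raised shifted i m = ins (if shifted then i else i ∸ 1) (if raised then inc (i ∸ 1) m else m)

Tᶜ : Bool → ℕ → (Monomial → ℤ) → Monomial → ℤ
Tᶜ s i φ m = Δ (χ s) (λ raised shifted → φ (probe raised shifted i m))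

coeff-T : ∀ i p m → coeff (T i p) m ≡ coeff p (probe true true i m) - coeff p (probe true false i m)
coeff-T i p m =
  trans (coeff-divX i (R (suc i) p ⊖ R i p) m)
        (trans (coeff-⊖ (R (suc i) p) (R i p) (inc (i ∸ 1) m))
               (cong₂ _-_ (coeff-R (suc i) p (inc (i ∸ 1) m)) (coeff-R i p (inc (i ∸ 1) m))))

mulX-T : ∀ i p → mulX i (T i p) ≈ R (suc i) p ⊖ R i p
mulX-T i p m rewrite coeff-mulX i (T i p) m | coeff-⊖ (R (suc i) p) (R i p) m
                   | coeff-R (suc i) p m | coeff-R i p m
  with get m (i ∸ 1) ≡ᵇ 0 in mᵢ≡ᵇ0
... | true  = sym (trans (cong (λ z → coeff p (ins i m) - z)
                               (sym (coeff-ins-zero i m (ℕ.≡ᵇ⇒≡ _ 0 (Equivalence.from T-≡ mᵢ≡ᵇ0)) p)))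
                         (ℤ.+-inverseʳ (coeff p (ins i m))))
... | false = trans (coeff-T i p _)
                    (cong (λ μ → coeff p (ins i μ) - coeff p (ins (i ∸ 1) μ)) (inc-dec (i ∸ 1) m mᵢ≡ᵇ0))

coeff-Tˢ : ∀ s i p m → coeff (Tˢ s i p) m ≡ Tᶜ s i (coeff p) m
coeff-Tˢ false i p m = trans (coeff-T i p m) (sym (Δ-zero λ r b → coeff p (probe r b i m)))
coeff-Tˢ true  i p m = begin
  coeff (T i p ⊕ mulX i (T i p)) m
    ≡⟨ coeff-++ (T i p) (mulX i (T i p)) m ⟩
  coeff (T i p) m + coeff (mulX i (T i p)) m
    ≡⟨ cong₂ _+_ (coeff-T i p m) (trans (mulX-T i p m) (coeff-⊖ (R (suc i) p) (R i p) m)) ⟩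
  Tᵢp + (coeff (R (suc i) p) m - coeff (R i p) m)
    ≡⟨ cong (_+_ Tᵢp) (cong₂ _-_ (coeff-R (suc i) p m) (coeff-R i p m)) ⟩
  Tᵢp + (coeff p (ins i m) - coeff p (ins (i ∸ 1) m))
    ≡⟨ Δ-one (λ r b → coeff p (probe r b i m)) ⟨
  Tᶜ true i (coeff p) m ∎
  where
  open ≡-Reasoning
  Tᵢp = coeff p (probe true true i m) - coeff p (probe true false i m)

-- _≈_ wrapped in a record, so that Agda can infer the polynomials it relates.
record _≃_ (p q : Poly) : Set where
  constructor coeffwise
  field coeff-≡ : p ≈ q

open _≃_

infix 4 _≃_

≃-setoid : Setoid 0ℓ 0ℓ
≃-setoid = record
  { Carrier       = Poly
  ; _≈_           = _≃_
  ; isEquivalence = record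
    { refl  = coeffwise λ _ → refl
    ; sym   = λ p≃q → coeffwise λ m → sym (coeff-≡ p≃q m)
    ; trans = λ p≃q q≃r → coeffwise λ m → trans (coeff-≡ p≃q m) (coeff-≡ q≃r m)
    }
  }

module ≃-Reasoning = Relation.Binary.Reasoning.Setoid ≃-setoid

open Setoid ≃-setoid using ()
  renaming (refl to ≃-refl; reflexive to ≃-reflexive; sym to ≃-sym; trans to ≃-trans)

⊕-cong : ∀ {p p′ q q′} → p ≃ p′ → q ≃ q′ → p ⊕ q ≃ p′ ⊕ q′
⊕-cong {p} {p′} {q} {q′} p≃p′ q≃q′ = coeffwise λ m →
  trans (coeff-++ p q m) (trans (cong₂ _+_ (coeff-≡ p≃p′ m) (coeff-≡ q≃q′ m)) (sym (coeff-++ p′ q′ m)))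

scale-cong : ∀ c {p q} → p ≃ q → scale c p ≃ scale c q
scale-cong c {p} {q} p≃q = coeffwise λ m →
  trans (coeff-scale c p m) (trans (cong (c *_) (coeff-≡ p≃q m)) (sym (coeff-scale c q m)))

record Linear (O : Poly → Poly) : Set where
  field
    cong-≃    : ∀ {p q} → p ≃ q → O p ≃ O q
    ⊕-hom     : ∀ p q → O (p ⊕ q) ≃ O p ⊕ O q
    scale-hom : ∀ c p → O (scale c p) ≃ scale c (O p)

  ⊖-hom : ∀ p q → O (p ⊖ q) ≃ O p ⊖ O q
  ⊖-hom p q = ≃-trans (⊕-hom p (scale (- + 1) q)) (⊕-cong ≃-refl (scale-hom (- + 1) q))

open Linear

id-linear : Linear (λ p → p)
id-linear = record { cong-≃ = λ p≃q → p≃q ; ⊕-hom = λ _ _ → ≃-refl ; scale-hom = λ _ _ → ≃-refl }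

∘-linear : ∀ {O O′} → Linear O → Linear O′ → Linear (O ∘ O′)
∘-linear {O} {O′} lin lin′ = record
  { cong-≃    = λ p≃q → cong-≃ lin (cong-≃ lin′ p≃q)
  ; ⊕-hom     = λ p q → ≃-trans (cong-≃ lin (⊕-hom lin′ p q)) (⊕-hom lin (O′ p) (O′ q))
  ; scale-hom = λ c p → ≃-trans (cong-≃ lin (scale-hom lin′ c p)) (scale-hom lin c (O′ p))
  }

record LinearFormula (Φ : (Monomial → ℤ) → Monomial → ℤ) : Set where
  field
    ext         : ∀ {φ ψ} → (∀ μ → φ μ ≡ ψ μ) → ∀ m → Φ φ m ≡ Φ ψ m
    additive    : ∀ φ ψ m → Φ (λ μ → φ μ + ψ μ) m ≡ Φ φ m + Φ ψ m
    homogeneous : ∀ c φ m → Φ (λ μ → c * φ μ) m ≡ c * Φ φ m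

linear-by-formula : ∀ {O Φ} → LinearFormula Φ → (∀ p m → coeff (O p) m ≡ Φ (coeff p) m) →
                    Linear O
linear-by-formula {O} {Φ} formula O≡Φ = record
  { cong-≃    = λ {p} {q} p≃q → coeffwise λ m →
      trans (O≡Φ p m) (trans (ext (coeff-≡ p≃q) m) (sym (O≡Φ q m)))
  ; ⊕-hom     = λ p q → coeffwise λ m → begin
      coeff (O (p ⊕ q)) m                   ≡⟨ O≡Φ (p ⊕ q) m ⟩
      Φ (coeff (p ⊕ q)) m                   ≡⟨ ext (coeff-++ p q) m ⟩
      Φ (λ μ → coeff p μ + coeff q μ) m     ≡⟨ additive (coeff p) (coeff q) m ⟩
      Φ (coeff p) m + Φ (coeff q) m         ≡⟨ cong₂ _+_ (O≡Φ p m) (O≡Φ q m) ⟨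
      coeff (O p) m + coeff (O q) m         ≡⟨ coeff-++ (O p) (O q) m ⟨
      coeff (O p ⊕ O q) m                   ∎
  ; scale-hom = λ c p → coeffwise λ m → begin
      coeff (O (scale c p)) m               ≡⟨ O≡Φ (scale c p) m ⟩
      Φ (coeff (scale c p)) m               ≡⟨ ext (coeff-scale c p) m ⟩
      Φ (λ μ → c * coeff p μ) m             ≡⟨ homogeneous c (coeff p) m ⟩
      c * Φ (coeff p) m                     ≡⟨ cong (c *_) (O≡Φ p m) ⟨
      c * coeff (O p) m                     ≡⟨ coeff-scale c (O p) m ⟨
      coeff (scale c (O p)) m               ∎
  }
  where
  open LinearFormula formula
  open ≡-Reasoning

pullback-formula : (g : Monomial → Monomial) → LinearFormula (λ φ m → φ (g m))
pullback-formula g = record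
  { ext = λ φ≗ψ m → φ≗ψ (g m) ; additive = λ _ _ _ → refl ; homogeneous = λ _ _ _ → refl }

Tᶜ-formula : ∀ s i → LinearFormula (Tᶜ s i)
Tᶜ-formula s i = record
  { ext         = λ φ≗ψ m → Δ-cong (χ s) λ r b → φ≗ψ (probe r b i m)
  ; additive    = λ φ ψ m → Δ-additive (χ s) (λ r b → φ (probe r b i m)) (λ r b → ψ (probe r b i m))
  ; homogeneous = λ k φ m → Δ-homogeneous (χ s) k (λ r b → φ (probe r b i m))
  }

R-linear : ∀ i → Linear (R i)
R-linear i = linear-by-formula (pullback-formula (ins (i ∸ 1))) (coeff-R i)

Tˢ-linear : ∀ s i → Linear (Tˢ s i)
Tˢ-linear s i = linear-by-formula (Tᶜ-formula s i) (coeff-Tˢ s i)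

Rs-linear : ∀ w → Linear (Rs w)
Rs-linear []      = id-linear
Rs-linear (j ∷ w) = ∘-linear (R-linear j) (Rs-linear w)

groveFuel-linear : ∀ n F → Linear (groveFuel n F)
groveFuel-linear zero    F = id-linear
groveFuel-linear (suc n) F with cherryF 0 F
... | nothing                = id-linear
... | just (i , true  , F′) = ∘-linear (groveFuel-linear n F′) (Tˢ-linear true i)
... | just (i , false , F′) = ∘-linear (groveFuel-linear n F′) (Tˢ-linear false i)

That-linear : ∀ F → Linear (That F)
That-linear F = groveFuel-linear (internalF F) F

ins-probe : ∀ {a J} → a < J → ∀ r b μ → ins (suc J) (probe r b (suc a) μ) ≡ probe r b (suc a) (ins J μ)
ins-probe {a} a<J true  true  μ = trans (ins-ins a<J (inc a μ)) (cong (ins (suc a)) (ins-inc-> a<J μ))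
ins-probe {a} a<J true  false μ = trans (ins-ins (ℕ.<⇒≤ a<J) (inc a μ)) (cong (ins a) (ins-inc-> a<J μ))
ins-probe     a<J false true  μ = ins-ins a<J μ
ins-probe     a<J false false μ = ins-ins (ℕ.<⇒≤ a<J) μ

inc-probe : ∀ {a J} → a < J → ∀ r b μ → inc (suc J) (probe r b (suc a) μ) ≡ probe r b (suc a) (inc J μ)
inc-probe {a} {J} a<J true  true  μ =
  trans (sym (ins-inc-≤ a<J (inc a μ))) (cong (ins (suc a)) (inc-inc J a μ))
inc-probe {a} {J} a<J true  false μ =
  trans (sym (ins-inc-≤ (ℕ.<⇒≤ a<J) (inc a μ))) (cong (ins a) (inc-inc J a μ))
inc-probe a<J false true  μ = sym (ins-inc-≤ a<J μ)
inc-probe a<J false false μ = sym (ins-inc-≤ (ℕ.<⇒≤ a<J) μ)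

ins-probe-≤ : ∀ {a j} → j ≤ a → ∀ r b μ → ins j (probe r b (suc a) μ) ≡ probe r b (suc (suc a)) (ins j μ)
ins-probe-≤ {a} j≤a true  true  μ =
  trans (sym (ins-ins (ℕ.m≤n⇒m≤1+n j≤a) (inc a μ))) (cong (ins (suc (suc a))) (ins-inc-≤ j≤a μ))
ins-probe-≤ {a} j≤a true  false μ =
  trans (sym (ins-ins j≤a (inc a μ))) (cong (ins (suc a)) (ins-inc-≤ j≤a μ))
ins-probe-≤ j≤a false true  μ = sym (ins-ins (ℕ.m≤n⇒m≤1+n j≤a) μ)
ins-probe-≤ j≤a false false μ = sym (ins-ins j≤a μ)

probe-comm : ∀ {a C} → a < C → ∀ r b r′ b′ μ →
  probe r′ b′ (suc (suc C)) (probe r b (suc a) μ) ≡ probe r b (suc a) (probe r′ b′ (suc C) μ)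
probe-comm {C = C} a<C r b true  true  μ =
  trans (cong (ins (suc (suc C))) (inc-probe a<C r b μ)) (ins-probe (ℕ.m<n⇒m<1+n a<C) r b (inc C μ))
probe-comm {C = C} a<C r b true  false μ =
  trans (cong (ins (suc C)) (inc-probe a<C r b μ)) (ins-probe a<C r b (inc C μ))
probe-comm a<C r b false true  μ = ins-probe (ℕ.m<n⇒m<1+n a<C) r b μ
probe-comm a<C r b false false μ = ins-probe a<C r b μ

Tᶜ-transport : ∀ s i i′ {g h : Monomial → Monomial} →
  (∀ r b μ → g (probe r b i μ) ≡ probe r b i′ (h μ)) → ∀ φ m → Tᶜ s i (φ ∘ g) m ≡ Tᶜ s i′ φ (h m)
Tᶜ-transport s i i′ g∘probe φ m = Δ-cong (χ s) λ r b → cong φ (g∘probe r b m)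

T-R-exchange : ∀ s i i′ j j′ → (∀ r b μ → ins (j ∸ 1) (probe r b i μ) ≡ probe r b i′ (ins (j′ ∸ 1) μ)) →
               ∀ f → Tˢ s i (R j f) ≃ R j′ (Tˢ s i′ f)
T-R-exchange s i i′ j j′ ins∘probe f = coeffwise λ m → begin
  coeff (Tˢ s i (R j f)) m               ≡⟨ coeff-Tˢ s i (R j f) m ⟩
  Tᶜ s i (coeff (R j f)) m               ≡⟨ LinearFormula.ext (Tᶜ-formula s i) (coeff-R j f) m ⟩
  Tᶜ s i (coeff f ∘ ins (j ∸ 1)) m       ≡⟨ Tᶜ-transport s i i′ {ins (j ∸ 1)} ins∘probe (coeff f) m ⟩
  Tᶜ s i′ (coeff f) (ins (j′ ∸ 1) m)     ≡⟨ coeff-Tˢ s i′ f (ins (j′ ∸ 1) m) ⟨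
  coeff (Tˢ s i′ f) (ins (j′ ∸ 1) m)     ≡⟨ coeff-R j′ (Tˢ s i′ f) m ⟨
  coeff (R j′ (Tˢ s i′ f)) m             ∎
  where open ≡-Reasoning

T-R-far : ∀ s {i j} → suc i < j → ∀ f → Tˢ s (suc i) (R (suc j) f) ≃ R j (Tˢ s (suc i) f)
T-R-far s {i} {suc c} (s≤s i<c) = T-R-exchange s (suc i) (suc i) (suc (suc c)) (suc c) (ins-probe i<c)

T-R-near : ∀ s {i j} → j ≤ i → ∀ f → Tˢ s (suc i) (R (suc j) f) ≃ R (suc j) (Tˢ s (suc (suc i)) f)
T-R-near s {i} {j} j≤i = T-R-exchange s (suc i) (suc (suc i)) (suc j) (suc j) (ins-probe-≤ j≤i)

T-R-adjacent : ∀ s a f → Tˢ s (suc a) (R (suc (suc a)) f) ≃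
                         R (suc a) (Tˢ s (suc (suc a)) f) ⊕ R (suc (suc a)) (Tˢ s (suc a) f)
T-R-adjacent s a f = coeffwise λ m → begin
  coeff (Tˢ s (suc a) (R (suc (suc a)) f)) m
    ≡⟨ coeff-Tˢ s (suc a) (R (suc (suc a)) f) m ⟩
  Tᶜ s (suc a) (coeff (R (suc (suc a)) f)) m
    ≡⟨ LinearFormula.ext (Tᶜ-formula s (suc a)) (coeff-R (suc (suc a)) f) m ⟩
  Tᶜ s (suc a) (φ ∘ ins (suc a)) m
    ≡⟨ Δ-telescope σ (λ r b → φ (ins (suc a) (probe r b (suc a) m))) (K m) (K′ m) ⟩
  Δ σ (grid (K m) (L₂ m) (K′ m) (L₄ m)) + Δ σ (grid (L₁ m) (K m) (L₃ m) (K′ m))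
    ≡⟨ cong₂ _+_ (Δ-cong σ (left m)) (Δ-cong σ (right m)) ⟩
  Tᶜ s (suc (suc a)) φ (ins a m) + Tᶜ s (suc a) φ (ins (suc a) m)
    ≡⟨ cong₂ _+_ (coeff-Tˢ s (suc (suc a)) f (ins a m)) (coeff-Tˢ s (suc a) f (ins (suc a) m)) ⟨
  coeff (Tˢ s (suc (suc a)) f) (ins a m) + coeff (Tˢ s (suc a) f) (ins (suc a) m)
    ≡⟨ cong₂ _+_ (coeff-R (suc a) (Tˢ s (suc (suc a)) f) m)
                 (coeff-R (suc (suc a)) (Tˢ s (suc a) f) m) ⟨
  coeff (R (suc a) (Tˢ s (suc (suc a)) f)) m + coeff (R (suc (suc a)) (Tˢ s (suc a) f)) m
    ≡⟨ coeff-++ (R (suc a) (Tˢ s (suc (suc a)) f)) (R (suc (suc a)) (Tˢ s (suc a) f)) m ⟨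
  coeff (R (suc a) (Tˢ s (suc (suc a)) f) ⊕ R (suc (suc a)) (Tˢ s (suc a) f)) m ∎
  where
  open ≡-Reasoning
  σ = χ s
  φ = coeff f
  L₁ L₂ L₃ L₄ K K′ : Monomial → ℤ
  L₁ m = φ (ins (suc a) (ins (suc a) (inc a m)))
  L₂ m = φ (ins (suc a) (ins a (inc a m)))
  L₃ m = φ (ins (suc a) (ins (suc a) m))
  L₄ m = φ (ins (suc a) (ins a m))
  K  m = φ (ins a (ins (suc a) (inc a m)))
  K′ m = φ (ins a (ins (suc a) m))
  left : ∀ m r b → grid (K m) (L₂ m) (K′ m) (L₄ m) r b ≡ φ (probe r b (suc (suc a)) (ins a m))
  left m true  true  = cong φ (sym (trans (cong (ins (suc (suc a))) (sym (ins-inc-≤ ℕ.≤-refl m)))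
                                          (ins-ins (ℕ.n≤1+n a) (inc a m))))
  left m true  false = cong φ (cong (ins (suc a)) (ins-inc-≤ ℕ.≤-refl m))
  left m false true  = cong φ (sym (ins-ins (ℕ.n≤1+n a) m))
  left m false false = refl
  right : ∀ m r b → grid (L₁ m) (K m) (L₃ m) (K′ m) r b ≡ φ (probe r b (suc a) (ins (suc a) m))
  right m true  true  = cong φ (cong (ins (suc a)) (ins-inc-> ℕ.≤-refl m))
  right m true  false = cong φ (cong (ins a) (ins-inc-> ℕ.≤-refl m))
  right m false true  = refl
  right m false false = refl

T-T-far : ∀ s t {a k} → suc a < k → ∀ f → Tˢ s (suc a) (Tˢ t (suc k) f) ≃ Tˢ t k (Tˢ s (suc a) f)
T-T-far s t {a} {suc C} (s≤s a<C) f = coeffwise λ m → begin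
  coeff (Tˢ s (suc a) (Tˢ t (suc (suc C)) f)) m
    ≡⟨ coeff-Tˢ s (suc a) (Tˢ t (suc (suc C)) f) m ⟩
  Tᶜ s (suc a) (coeff (Tˢ t (suc (suc C)) f)) m
    ≡⟨ LinearFormula.ext (Tᶜ-formula s (suc a)) (coeff-Tˢ t (suc (suc C)) f) m ⟩
  Tᶜ s (suc a) (Tᶜ t (suc (suc C)) φ) m
    ≡⟨ Δ-cong (χ s) (λ r b → sym (Tᶜ-transport t (suc C) (suc (suc C)) {probe r b (suc a)}
                                    (λ r′ b′ μ → sym (probe-comm a<C r b r′ b′ μ)) φ m)) ⟩
  Δ (χ s) (λ r b → Δ (χ t) (λ r′ b′ → φ (probe r b (suc a) (probe r′ b′ (suc C) m))))
    ≡⟨ Δ-swap (χ s) (χ t) (λ r b r′ b′ → φ (probe r b (suc a) (probe r′ b′ (suc C) m))) ⟩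
  Tᶜ t (suc C) (Tᶜ s (suc a) φ) m
    ≡⟨ LinearFormula.ext (Tᶜ-formula t (suc C)) (coeff-Tˢ s (suc a) f) m ⟨
  Tᶜ t (suc C) (coeff (Tˢ s (suc a) f)) m
    ≡⟨ coeff-Tˢ t (suc C) (Tˢ s (suc a) f) m ⟨
  coeff (Tˢ t (suc C) (Tˢ s (suc a) f)) m ∎
  where
  open ≡-Reasoning
  φ = coeff f

Tˢ-change : ∀ s s′ i f → Tˢ s i f ≃ Tˢ s′ i f ⊕ scale (χ s - χ s′) (R (suc i) f ⊖ R i f)
Tˢ-change s s′ i f = coeffwise λ m → begin
  coeff (Tˢ s i f) m
    ≡⟨ coeff-Tˢ s i f m ⟩
  Tᶜ s i φ m
    ≡⟨ Δ-change (χ s) (χ s′) (λ r b → φ (probe r b i m)) ⟩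
  Tᶜ s′ i φ m + (χ s - χ s′) * (φ (ins i m) - φ (ins (i ∸ 1) m))
    ≡⟨ cong₂ _+_ (coeff-Tˢ s′ i f m)
                 (cong ((χ s - χ s′) *_) (trans (coeff-⊖ (R (suc i) f) (R i f) m)
                                                (cong₂ _-_ (coeff-R (suc i) f m) (coeff-R i f m)))) ⟨
  coeff (Tˢ s′ i f) m + (χ s - χ s′) * coeff (R (suc i) f ⊖ R i f) m
    ≡⟨ cong (_+_ (coeff (Tˢ s′ i f) m)) (coeff-scale (χ s - χ s′) (R (suc i) f ⊖ R i f) m) ⟨
  coeff (Tˢ s′ i f) m + coeff (scale (χ s - χ s′) (R (suc i) f ⊖ R i f)) m
    ≡⟨ coeff-++ (Tˢ s′ i f) (scale (χ s - χ s′) (R (suc i) f ⊖ R i f)) m ⟨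
  coeff (Tˢ s′ i f ⊕ scale (χ s - χ s′) (R (suc i) f ⊖ R i f)) m ∎
  where
  open ≡-Reasoning
  φ = coeff f

cherryNode : Bool → Tree → Tree → Maybe (ℕ × Bool × Tree) → Maybe (ℕ × Bool × Tree) →
             Maybe (ℕ × Bool × Tree)
cherryNode b l r (just (k , s , l′)) _                   = just (k , s , node l′ r)
cherryNode b l r nothing             (just (k , s , r′)) = just (leaves l ℕ.+ k , s , node l r′)
cherryNode b l r nothing             nothing             = just (0 , b , leaf)

-- cherry without overlapping clauses, so that it reduces on every node (cherry≡cherry′).
cherry′ : Bool → Tree → Maybe (ℕ × Bool × Tree)
cherry′ b leaf       = nothing
cherry′ b (node l r) = cherryNode b l r (cherry′ false l) (cherry′ true r)

prepend : Tree → ℕ × Bool × Forest → ℕ × Bool × Forest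
prepend t (i , s , ts) = i , s , t ∷ ts

cherryF′ : ℕ → Forest → Maybe (ℕ × Bool × Forest)
cherryCons : ℕ → Tree → Forest → Maybe (ℕ × Bool × Tree) → Maybe (ℕ × Bool × Forest)

cherryF′ off []       = nothing
cherryF′ off (t ∷ ts) = cherryCons off t ts (cherry′ false t)

cherryCons off t ts (just (k , s , t′)) = just (suc (off ℕ.+ k) , s , t′ ∷ ts)
cherryCons off t ts nothing             = Maybe.map (prepend t) (cherryF′ (off ℕ.+ leaves t) ts)

cherry′-nothing : ∀ b t → cherry′ b t ≡ nothing → t ≡ leaf
cherry′-nothing b leaf       _  = refl
cherry′-nothing b (node l r) eq with cherry′ false l | cherry′ true r | eq
... | just _  | _       | ()
... | nothing | just _  | ()
... | nothing | nothing | ()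

cherry′-node : ∀ b l r → Σ (ℕ × Bool × Tree) λ x → cherry′ b (node l r) ≡ just x
cherry′-node b l r with cherry′ b (node l r) in eq
... | just x  = x , refl
... | nothing = contradiction (cherry′-nothing b (node l r) eq) λ ()

cherry≡cherry′ : ∀ b t → cherry b t ≡ cherry′ b t
cherry≡cherry′ b leaf                   = refl
cherry≡cherry′ b (node leaf leaf)       = refl
cherry≡cherry′ b (node leaf (node a c))
  rewrite cherry≡cherry′ true (node a c) | proj₂ (cherry′-node true a c) = refl
cherry≡cherry′ b (node (node a c) r)
  rewrite cherry≡cherry′ false (node a c) | proj₂ (cherry′-node false a c) = refl

cherryF≡cherryF′ : ∀ off F → cherryF off F ≡ cherryF′ off F
cherryF≡cherryF′ off []       = refl
cherryF≡cherryF′ off (t ∷ ts) rewrite cherry≡cherry′ false t with cherry′ false t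
... | just (k , s , t′) = refl
... | nothing rewrite cherryF≡cherryF′ (off ℕ.+ leaves t) ts with cherryF′ (off ℕ.+ leaves t) ts
...   | just (i , s , ts′) = refl
...   | nothing            = refl

cherry′-internal : ∀ b t {k s t′} → cherry′ b t ≡ just (k , s , t′) → internal t ≡ suc (internal t′)
cherry′-internal b (node l r) eq with cherry′ false l in cherryₗ | cherry′ true r in cherryᵣ | eq
... | just _  | _       | refl = cong (λ n → suc (n ℕ.+ internal r)) (cherry′-internal false l cherryₗ)
... | nothing | just _  | refl =
  cong suc (trans (cong (internal l ℕ.+_) (cherry′-internal true r cherryᵣ)) (ℕ.+-suc (internal l) _))
... | nothing | nothing | refl
  with refl ← cherry′-nothing false l cherryₗ | refl ← cherry′-nothing true r cherryᵣ = refl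

cherry′-leaves : ∀ b t {k s t′} → cherry′ b t ≡ just (k , s , t′) → leaves t ≡ suc (leaves t′)
cherry′-leaves b (node l r) eq with cherry′ false l in cherryₗ | cherry′ true r in cherryᵣ | eq
... | just _  | _       | refl = cong (ℕ._+ leaves r) (cherry′-leaves false l cherryₗ)
... | nothing | just _  | refl =
  trans (cong (leaves l ℕ.+_) (cherry′-leaves true r cherryᵣ)) (ℕ.+-suc (leaves l) _)
... | nothing | nothing | refl
  with refl ← cherry′-nothing false l cherryₗ | refl ← cherry′-nothing true r cherryᵣ = refl

cherry′-right-leaf : ∀ b t {k s t′} → cherry′ b t ≡ just (k , s , t′) → suc k < leaves t
cherry′-right-leaf b (node l r) eq with cherry′ false l in cherryₗ | cherry′ true r in cherryᵣ | eq
... | just _  | _       | refl = ℕ.<-≤-trans (cherry′-right-leaf false l cherryₗ) (ℕ.m≤m+n (leaves l) (leaves r))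
... | nothing | just _  | refl with refl ← cherry′-nothing false l cherryₗ = s≤s (cherry′-right-leaf true r cherryᵣ)
... | nothing | nothing | refl
  with refl ← cherry′-nothing false l cherryₗ | refl ← cherry′-nothing true r cherryᵣ = ℕ.≤-refl

-- splitLeaf p t replaces the leaf p (0-based) of t by a cherry, or returns p − n when t has
-- only n ≤ p leaves.
splitLeaf : ℕ → Tree → Tree ⊎ ℕ
splitLeaf p       (node l r) =
  [ (λ l″ → inj₁ (node l″ r)) , (λ q → Sum.map₁ (node l) (splitLeaf q r)) ]′ (splitLeaf p l)
splitLeaf zero    leaf       = inj₁ (node leaf leaf)
splitLeaf (suc q) leaf       = inj₂ q

splitF : ℕ → Forest → Forest
splitF p       (t ∷ ts) = [ (λ t″ → t″ ∷ ts) , (λ q → t ∷ splitF q ts) ]′ (splitLeaf p t)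
splitF zero    []       = node leaf leaf ∷ []
splitF (suc p) []       = leaf ∷ splitF p []

splitLeaf-internal : ∀ p t {t″} → splitLeaf p t ≡ inj₁ t″ → internal t″ ≡ suc (internal t)
splitLeaf-internal zero leaf       refl = refl
splitLeaf-internal p    (node l r) eq with splitLeaf p l in splitₗ | eq
... | inj₁ _ | refl = cong (λ n → suc (n ℕ.+ internal r)) (splitLeaf-internal p l splitₗ)
... | inj₂ q | eq′ with splitLeaf q r in splitᵣ | eq′
...   | inj₁ _ | refl =
  cong suc (trans (cong (internal l ℕ.+_) (splitLeaf-internal q r splitᵣ)) (ℕ.+-suc (internal l) _))

splitLeaf-beyond : ∀ t q → splitLeaf (leaves t ℕ.+ q) t ≡ inj₂ q
splitLeaf-beyond leaf       q = refl
splitLeaf-beyond (node l r) q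
  rewrite ℕ.+-assoc (leaves l) (leaves r) q | splitLeaf-beyond l (leaves r ℕ.+ q)
        | splitLeaf-beyond r q = refl

splitLeaf-inj₂ : ∀ p t {q} → splitLeaf p t ≡ inj₂ q → p ≡ leaves t ℕ.+ q
splitLeaf-inj₂ (suc p) leaf       refl = refl
splitLeaf-inj₂ p       (node l r) eq with splitLeaf p l in splitₗ | eq
... | inj₂ q₁ | eq′ with splitLeaf q₁ r in splitᵣ | eq′
...   | inj₂ q₂ | refl =
  trans (splitLeaf-inj₂ p l splitₗ)
        (trans (cong (leaves l ℕ.+_) (splitLeaf-inj₂ q₁ r splitᵣ)) (sym (ℕ.+-assoc (leaves l) (leaves r) q₂)))

splitF-internal : ∀ p G → internalF (splitF p G) ≡ suc (internalF G)
splitF-internal zero    []       = refl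
splitF-internal (suc p) []       = splitF-internal p []
splitF-internal p       (t ∷ ts) with splitLeaf p t in split≡
... | inj₁ _ = cong (ℕ._+ internalF ts) (splitLeaf-internal p t split≡)
... | inj₂ q = trans (cong (internal t ℕ.+_) (splitF-internal q ts)) (ℕ.+-suc (internal t) _)

cherryF′-internal : ∀ off F {i s F′} → cherryF′ off F ≡ just (i , s , F′) →
                    internalF F ≡ suc (internalF F′)
cherryF′-internal off (t ∷ ts) eq with cherry′ false t in cherryₜ | eq
... | just _  | refl = cong (ℕ._+ internalF ts) (cherry′-internal false t cherryₜ)
... | nothing | eq′ with cherryF′ (off ℕ.+ leaves t) ts in cherryₜₛ | eq′
...   | just _ | refl with refl ← cherry′-nothing false t cherryₜ = cherryF′-internal (off ℕ.+ 1) ts cherryₜₛ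

cherryF′-nothing : ∀ off F → cherryF′ off F ≡ nothing → internalF F ≡ 0
cherryF′-nothing off []       _  = refl
cherryF′-nothing off (t ∷ ts) eq with cherry′ false t in cherryₜ | eq
... | nothing | eq′ with cherryF′ (off ℕ.+ leaves t) ts in cherryₜₛ | eq′
...   | nothing | refl with refl ← cherry′-nothing false t cherryₜ = cherryF′-nothing (off ℕ.+ 1) ts cherryₜₛ

cherryF′-index : ∀ off F {i s F′} → cherryF′ off F ≡ just (i , s , F′) → off < i
cherryF′-index off (t ∷ ts) eq with cherry′ false t | eq
... | just (k , _ , _) | refl = s≤s (ℕ.m≤m+n off k)
... | nothing          | eq′ with cherryF′ (off ℕ.+ leaves t) ts in cherryₜₛ | eq′
...   | just _ | refl = ℕ.≤-<-trans (ℕ.m≤m+n off (leaves t)) (cherryF′-index (off ℕ.+ leaves t) ts cherryₜₛ)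

That-step : ∀ F {i s F′} → cherryF′ 0 F ≡ just (i , s , F′) → ∀ g → That F g ≡ That F′ (Tˢ s i g)
That-step F {i} {s} {F′} eq g
  rewrite cherryF′-internal 0 F eq | cherryF≡cherryF′ 0 F | eq with s
... | true  = refl
... | false = refl

That-trivial : ∀ F → internalF F ≡ 0 → ∀ g → That F g ≡ g
That-trivial F internal≡0 g rewrite internal≡0 = refl

+-cancelˡ-≤-suc : ∀ off {p k} → off ℕ.+ p ≤ suc (off ℕ.+ k) → p ≤ suc k
+-cancelˡ-≤-suc off {p} {k} le = ℕ.+-cancelˡ-≤ off p (suc k) (subst (off ℕ.+ p ≤_) (sym (ℕ.+-suc off k)) le)

cherry′-splitLeaf-before : ∀ b p t {t″} → splitLeaf p t ≡ inj₁ t″ →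
  (∀ {k s t′} → cherry′ b t ≡ just (k , s , t′) → p ≤ suc k) →
  Σ Bool λ s → cherry′ b t″ ≡ just (p , s , t)
cherry′-splitLeaf-before b zero leaf refl _ = b , refl
cherry′-splitLeaf-before b p (node l r) split≡ notBefore with splitLeaf p l in splitₗ
... | inj₁ l″ with refl ← split≡
  with s , cherry≡ ← cherry′-splitLeaf-before false p l splitₗ
                       (notBefore ∘ cong (λ c → cherryNode b l r c (cherry′ true r)))
  = s , cong (λ c → cherryNode b l″ r c (cherry′ true r)) cherry≡
... | inj₂ q with cherry′ false l in cherryₗ
...   | just (k , _ , _) = contradiction (notBefore refl) (ℕ.<⇒≱ right-leaf<p)
  where
  right-leaf<p : suc k < p
  right-leaf<p = ℕ.<-≤-trans (cherry′-right-leaf false l cherryₗ)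
                   (ℕ.≤-trans (ℕ.m≤m+n (leaves l) q) (ℕ.≤-reflexive (sym (splitLeaf-inj₂ p l splitₗ))))
...   | nothing with refl ← cherry′-nothing false l cherryₗ
  with refl ← splitLeaf-inj₂ p leaf splitₗ
  with splitLeaf q r in splitᵣ
...     | inj₂ _ with () ← split≡
...     | inj₁ r″ with refl ← split≡
  with s , cherry≡ ← cherry′-splitLeaf-before true q r splitᵣ
                       (ℕ.≤-pred ∘ notBefore ∘ cong (cherryNode b leaf r nothing))
  = s , cong (cherryNode b leaf r″ nothing) cherry≡

cherryF′-splitF-[] : ∀ off p → Σ Bool λ s → Σ Forest λ G″ →
  cherryF′ off (splitF p []) ≡ just (suc (off ℕ.+ p) , s , G″) × internalF G″ ≡ 0
cherryF′-splitF-[] off zero    = false , leaf ∷ [] , refl , refl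
cherryF′-splitF-[] off (suc p) with cherryF′-splitF-[] (off ℕ.+ 1) p
... | s , G″ , cherry≡ , trivial rewrite cherry≡ | ℕ.+-assoc off 1 p = s , leaf ∷ G″ , refl , trivial

cherryF′-splitF-before : ∀ off G p → (∀ {i s G′} → cherryF′ off G ≡ just (i , s , G′) → off ℕ.+ p ≤ i) →
  Σ Bool λ s → Σ Forest λ G″ → cherryF′ off (splitF p G) ≡ just (suc (off ℕ.+ p) , s , G″) ×
                               (G″ ≡ G ⊎ internalF G″ ≡ 0 × internalF G ≡ 0)
cherryF′-splitF-before off [] p _ with s , G″ , cherry≡ , trivial ← cherryF′-splitF-[] off p
  = s , G″ , cherry≡ , inj₂ (trivial , refl)
cherryF′-splitF-before off (t ∷ ts) p notBefore with splitLeaf p t in splitₜ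
... | inj₁ t″
  with s , cherry≡ ← cherry′-splitLeaf-before false p t splitₜ
                       (+-cancelˡ-≤-suc off ∘ notBefore ∘ cong (cherryCons off t ts))
  = s , t ∷ ts , cong (cherryCons off t″ ts) cherry≡ , inj₁ refl
... | inj₂ q with cherry′ false t in cherryₜ
...   | just (k , _ , _) = contradiction (+-cancelˡ-≤-suc off (notBefore refl)) (ℕ.<⇒≱ right-leaf<p)
  where
  right-leaf<p : suc k < p
  right-leaf<p = ℕ.<-≤-trans (cherry′-right-leaf false t cherryₜ)
                   (ℕ.≤-trans (ℕ.m≤m+n (leaves t) q) (ℕ.≤-reflexive (sym (splitLeaf-inj₂ p t splitₜ))))
...   | nothing with refl ← cherry′-nothing false t cherryₜ
  with refl ← splitLeaf-inj₂ p leaf splitₜ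
  with s , G″ , cherry≡ , same ← cherryF′-splitF-before (off ℕ.+ 1) ts q
         (λ {i} e → subst (_≤ i) (sym (ℕ.+-assoc off 1 q)) (notBefore (cong (Maybe.map (prepend leaf)) e)))
  = s , leaf ∷ G″ ,
    trans (cong (Maybe.map (prepend leaf)) cherry≡)
          (cong (λ n → just (suc n , s , leaf ∷ G″)) (ℕ.+-assoc off 1 q)) ,
    Sum.map₁ (cong (leaf ∷_)) same

splitLeaf-leaf : ∀ p {t″} → splitLeaf p leaf ≡ inj₁ t″ → p ≡ 0
splitLeaf-leaf zero refl = refl

splitLeaf-node-leaf : ∀ q t → 0 < q → splitLeaf q (node leaf t) ≡ Sum.map₁ (node leaf) (splitLeaf (q ∸ 1) t)
splitLeaf-node-leaf (suc q) t _ = refl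

cherry′-splitLeaf-after : ∀ b p t {t″ k s t′} → splitLeaf p t ≡ inj₁ t″ → cherry′ b t ≡ just (k , s , t′) →
  suc k < p → Σ Tree λ t‴ → splitLeaf (p ∸ 1) t′ ≡ inj₁ t‴ × cherry′ b t″ ≡ just (k , s , t‴)
cherry′-splitLeaf-after b p (node l r) split≡ cherry≡ k<p
  with splitLeaf p l in splitₗ | cherry′ false l in cherryₗ
... | inj₁ l″ | just _ with refl ← split≡ | refl ← cherry≡
  with l‴ , splitₗ′ , cherryₗ″ ← cherry′-splitLeaf-after false p l splitₗ cherryₗ k<p
  rewrite splitₗ′ = node l‴ r , refl , cong (λ c → cherryNode b l″ r c (cherry′ true r)) cherryₗ″
... | inj₁ _ | nothing with refl ← cherry′-nothing false l cherryₗ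
  with refl ← splitLeaf-leaf p splitₗ with () ← k<p
... | inj₂ q | just (_ , _ , l′) with splitLeaf q r in splitᵣ
...   | inj₂ _ with () ← split≡
...   | inj₁ r″ with refl ← split≡ | refl ← cherry≡
  with refl ← splitLeaf-inj₂ p l splitₗ
  rewrite cherry′-leaves false l cherryₗ | splitLeaf-beyond l′ q | splitᵣ
  = node l′ r″ , refl , cong (λ c → cherryNode b l r″ c (cherry′ true r″)) cherryₗ
cherry′-splitLeaf-after b p (node l r) split≡ cherry≡ k<p | inj₂ q | nothing
  with refl ← cherry′-nothing false l cherryₗ
  with refl ← splitLeaf-inj₂ p leaf splitₗ
  with splitLeaf q r in splitᵣ
...   | inj₂ _ with () ← split≡
...   | inj₁ r″ with refl ← split≡ with cherry′ true r in cherryᵣ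
...     | nothing with refl ← cherry′-nothing true r cherryᵣ | refl ← cherry≡
  with refl ← splitLeaf-leaf q splitᵣ = contradiction k<p (ℕ.<-irrefl refl)
...     | just (k₂ , s₂ , r′) with refl ← cherry≡
  with r‴ , splitᵣ′ , cherryᵣ″ ← cherry′-splitLeaf-after true q r splitᵣ cherryᵣ (ℕ.≤-pred k<p)
  rewrite splitLeaf-node-leaf q r′ (ℕ.<-trans (s≤s z≤n) (ℕ.≤-pred k<p)) | splitᵣ′
  = node leaf r‴ , refl , cong (cherryNode b leaf r″ nothing) cherryᵣ″

cherryF′-splitF-after : ∀ off G p {i₀ s₀ G′} → cherryF′ off G ≡ just (i₀ , s₀ , G′) → i₀ < off ℕ.+ p →
  cherryF′ off (splitF p G) ≡ just (i₀ , s₀ , splitF (p ∸ 1) G′)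
cherryF′-splitF-after off (t ∷ ts) p cherry≡ i₀<p with cherry′ false t in cherryₜ
... | just (k , s , t′) with refl ← cherry≡ with splitLeaf p t in splitₜ
...   | inj₁ t″
  with t‴ , splitₜ′ , cherryₜ″ ← cherry′-splitLeaf-after false p t splitₜ cherryₜ
                                    (ℕ.+-cancelˡ-< off (suc k) p (subst (_< off ℕ.+ p) (sym (ℕ.+-suc off k)) i₀<p))
  rewrite cherryₜ″ | splitₜ′ = refl
...   | inj₂ q with refl ← splitLeaf-inj₂ p t splitₜ
  rewrite cherryₜ | cherry′-leaves false t cherryₜ | splitLeaf-beyond t′ q = refl
cherryF′-splitF-after off (t ∷ ts) p cherry≡ i₀<p | nothing
  with refl ← cherry′-nothing false t cherryₜ with cherryF′ (off ℕ.+ 1) ts in cherryₜₛ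
...   | nothing with () ← cherry≡
...   | just (i₁ , s₁ , ts′) with refl ← cherry≡ = shifted p i₀<p
  where
  index : off ℕ.+ 1 < i₁
  index = cherryF′-index (off ℕ.+ 1) ts cherryₜₛ
  shifted : ∀ p → i₁ < off ℕ.+ p →
            cherryF′ off (splitF p (leaf ∷ ts)) ≡ just (i₁ , s₁ , splitF (p ∸ 1) (leaf ∷ ts′))
  shifted zero             i₁<p = contradiction (ℕ.<-≤-trans i₁<p (ℕ.+-monoʳ-≤ off z≤n)) (ℕ.<-asym index)
  shifted (suc zero)       i₁<p = contradiction i₁<p (ℕ.<-asym index)
  shifted (suc (suc p′)) i₁<p
    rewrite cherryF′-splitF-after (off ℕ.+ 1) ts (suc p′) cherryₜₛ
              (subst (i₁ <_) (sym (ℕ.+-assoc off 1 (suc p′))) i₁<p) = refl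

That-same : ∀ G G″ → G″ ≡ G ⊎ internalF G″ ≡ 0 × internalF G ≡ 0 → ∀ g → That G″ g ≡ That G g
That-same G G″ (inj₁ refl)                     g = refl
That-same G G″ (inj₂ (G″-trivial , G-trivial)) g =
  trans (That-trivial G″ G″-trivial g) (sym (That-trivial G G-trivial g))

That-splitF-first : ∀ G p → (∀ {i s G′} → cherryF′ 0 G ≡ just (i , s , G′) → p ≤ i) →
  Σ Bool λ s → ∀ f → That (splitF p G) f ≃ That G (Tˢ s (suc p) f)
That-splitF-first G p notBefore with s , G″ , cherry≡ , same ← cherryF′-splitF-before 0 G p notBefore
  = s , λ f → coeffwise λ m → cong (λ h → coeff h m)
              (trans (That-step (splitF p G) cherry≡ f) (That-same G G″ same (Tˢ s (suc p) f)))

-- When the new cherry is not the leftmost one, the leftmost cherry is contracted first, and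
-- T-T-far moves the two operators past each other.
That-splitF : ∀ G p → Acc _<_ (internalF G) →
  Σ Bool λ s → ∀ f → That (splitF p G) f ≃ That G (Tˢ s (suc p) f)
That-splitF G p _ with cherryF′ 0 G in cherry≡
... | nothing = That-splitF-first G p λ e → case trans (sym cherry≡) e of λ ()
... | just (zero , _ , _) with () ← cherryF′-index 0 G cherry≡
That-splitF G p (acc smaller) | just (suc a , s₀ , G′) with p ℕ.≤? suc a
...   | yes p≤i = That-splitF-first G p λ e → case trans (sym cherry≡) e of λ { refl → p≤i }
...   | no p≰i with ℕ.≰⇒> p≰i
...     | i<p@(s≤s {n = c} _)
  with s , splitF≃ ← That-splitF G′ c (smaller (ℕ.≤-reflexive (sym (cherryF′-internal 0 G cherry≡))))
  = s , λ f → begin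
    That (splitF (suc c) G) f
      ≡⟨ That-step (splitF (suc c) G) (cherryF′-splitF-after 0 G (suc c) cherry≡ i<p) f ⟩
    That (splitF c G′) (Tˢ s₀ (suc a) f)
      ≈⟨ splitF≃ (Tˢ s₀ (suc a) f) ⟩
    That G′ (Tˢ s (suc c) (Tˢ s₀ (suc a) f))
      ≈⟨ cong-≃ (That-linear G′) (T-T-far s₀ s i<p f) ⟨
    That G′ (Tˢ s₀ (suc a) (Tˢ s (suc (suc c)) f))
      ≡⟨ That-step G cherry≡ (Tˢ s (suc (suc c)) f) ⟨
    That G (Tˢ s (suc (suc c)) f) ∎
  where open ≃-Reasoning

Term : Set
Term = ℤ × List ℕ × Forest

PositiveIndices : List Term → Set
PositiveIndices = All (λ term → All (λ j → 1 ≤ j) (proj₁ (proj₂ term)))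

Bounded : ℕ → List Term → Set
Bounded n = All (λ term → internalF (proj₂ (proj₂ term)) ≤ n)

-- The bound n on the number of internal nodes of the forests G is what lets the induction in
-- That-R-expansion recurse on them.
record Expansion (n : ℕ) (O : Poly → Poly) : Set where
  field
    terms    : List Term
    positive : PositiveIndices terms
    bounded  : Bounded n terms
    expands  : ∀ f → O f ≃ linComb terms f

open Expansion

scaleTerms : ℤ → List Term → List Term
scaleTerms c = map (Product.map₁ (c *_))

prefixR : ℕ → List Term → List Term
prefixR j = map (Product.map₂ (Product.map₁ (j ∷_)))

linComb-++ : ∀ L₁ L₂ f → linComb (L₁ ++ L₂) f ≡ linComb L₁ f ⊕ linComb L₂ f
linComb-++ []                  L₂ f = refl
linComb-++ ((c , w , G) ∷ L₁) L₂ f =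
  trans (cong (scale c (Rs w (That G f)) ⊕_) (linComb-++ L₁ L₂ f))
        (sym (List.++-assoc (scale c (Rs w (That G f))) (linComb L₁ f) (linComb L₂ f)))

scale-scale : ∀ c d p → scale c (scale d p) ≃ scale (c * d) p
scale-scale c d p = coeffwise λ m → begin
  coeff (scale c (scale d p)) m  ≡⟨ coeff-scale c (scale d p) m ⟩
  c * coeff (scale d p) m        ≡⟨ cong (c *_) (coeff-scale d p m) ⟩
  c * (d * coeff p m)            ≡⟨ ℤ.*-assoc c d (coeff p m) ⟨
  c * d * coeff p m              ≡⟨ coeff-scale (c * d) p m ⟨
  coeff (scale (c * d) p) m      ∎
  where open ≡-Reasoning

linComb-scaleTerms : ∀ c L f → linComb (scaleTerms c L) f ≃ scale c (linComb L f)
linComb-scaleTerms c []              f = ≃-refl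
linComb-scaleTerms c ((d , w , G) ∷ L) f = begin
  scale (c * d) X ⊕ linComb (scaleTerms c L) f
    ≈⟨ ⊕-cong (≃-sym (scale-scale c d X)) (linComb-scaleTerms c L f) ⟩
  scale c (scale d X) ⊕ scale c (linComb L f)
    ≡⟨ List.map-++ _ (scale d X) (linComb L f) ⟨
  scale c (scale d X ⊕ linComb L f) ∎
  where
  open ≃-Reasoning
  X = Rs w (That G f)

linComb-prefixR : ∀ j L f → linComb (prefixR j L) f ≃ R j (linComb L f)
linComb-prefixR j []                f = ≃-refl
linComb-prefixR j ((d , w , G) ∷ L) f = begin
  scale d (R j X) ⊕ linComb (prefixR j L) f
    ≈⟨ ⊕-cong (≃-sym (scale-hom (R-linear j) d X)) (linComb-prefixR j L f) ⟩
  R j (scale d X) ⊕ R j (linComb L f)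
    ≈⟨ ⊕-hom (R-linear j) (scale d X) (linComb L f) ⟨
  R j (scale d X ⊕ linComb L f) ∎
  where
  open ≃-Reasoning
  X = Rs w (That G f)

Expansion-cong : ∀ {n O O′} → (∀ f → O′ f ≃ O f) → Expansion n O → Expansion n O′
Expansion-cong O′≃O E = record
  { terms = terms E ; positive = positive E ; bounded = bounded E
  ; expands = λ f → ≃-trans (O′≃O f) (expands E f) }

Expansion-weaken : ∀ {n n′ O} → n ≤ n′ → Expansion n O → Expansion n′ O
Expansion-weaken n≤n′ E = record
  { terms = terms E ; positive = positive E ; expands = expands E
  ; bounded = All.map (λ G≤n → ℕ.≤-trans G≤n n≤n′) (bounded E) }

Expansion-zero : ∀ {n} → Expansion n (λ _ → zeroP)
Expansion-zero = record { terms = [] ; positive = [] ; bounded = [] ; expands = λ _ → ≃-refl }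

linComb-single : ∀ G f → linComb ((+ 1 , [] , G) ∷ []) f ≃ That G f
linComb-single G f = coeffwise λ m → begin
  coeff (scale (+ 1) (That G f) ⊕ []) m   ≡⟨ coeff-++ (scale (+ 1) (That G f)) [] m ⟩
  coeff (scale (+ 1) (That G f)) m + + 0  ≡⟨ ℤ.+-identityʳ _ ⟩
  coeff (scale (+ 1) (That G f)) m        ≡⟨ coeff-scale (+ 1) (That G f) m ⟩
  + 1 * coeff (That G f) m                ≡⟨ ℤ.*-identityˡ _ ⟩
  coeff (That G f) m                      ∎
  where open ≡-Reasoning

Expansion-That : ∀ G → Expansion (internalF G) (That G)
Expansion-That G = record
  { terms    = (+ 1 , [] , G) ∷ []
  ; positive = [] ∷ []
  ; bounded  = ℕ.≤-refl ∷ []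
  ; expands  = λ f → ≃-sym (linComb-single G f)
  }

Expansion-⊕ : ∀ {n O₁ O₂} → Expansion n O₁ → Expansion n O₂ → Expansion n (λ f → O₁ f ⊕ O₂ f)
Expansion-⊕ E₁ E₂ = record
  { terms    = terms E₁ ++ terms E₂
  ; positive = All.++⁺ (positive E₁) (positive E₂)
  ; bounded  = All.++⁺ (bounded E₁) (bounded E₂)
  ; expands  = λ f → ≃-trans (⊕-cong (expands E₁ f) (expands E₂ f))
                             (≃-reflexive (sym (linComb-++ (terms E₁) (terms E₂) f)))
  }

Expansion-scale : ∀ {n O} c → Expansion n O → Expansion n (λ f → scale c (O f))
Expansion-scale c E = record
  { terms    = scaleTerms c (terms E)
  ; positive = All.map⁺ (positive E)
  ; bounded  = All.map⁺ (bounded E)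
  ; expands  = λ f → ≃-trans (scale-cong c (expands E f)) (≃-sym (linComb-scaleTerms c (terms E) f))
  }

Expansion-⊖ : ∀ {n O₁ O₂} → Expansion n O₁ → Expansion n O₂ → Expansion n (λ f → O₁ f ⊖ O₂ f)
Expansion-⊖ E₁ E₂ = Expansion-⊕ E₁ (Expansion-scale (- + 1) E₂)

Expansion-R : ∀ {n O j} → 1 ≤ j → Expansion n O → Expansion n (R j ∘ O)
Expansion-R {j = j} 1≤j E = record
  { terms    = prefixR j (terms E)
  ; positive = All.map⁺ (All.map (1≤j ∷_) (positive E))
  ; bounded  = All.map⁺ (bounded E)
  ; expands  = λ f → ≃-trans (cong-≃ (R-linear j) (expands E f)) (≃-sym (linComb-prefixR j (terms E) f))
  }

Expansion-Rs : ∀ {n O} w → All (λ j → 1 ≤ j) w → Expansion n O → Expansion n (Rs w ∘ O)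
Expansion-Rs []      []            E = E
Expansion-Rs (j ∷ w) (1≤j ∷ 1≤w) E = Expansion-R 1≤j (Expansion-Rs w 1≤w E)

Expansion-linComb : ∀ {n m P} L → PositiveIndices L → Bounded n L →
  (∀ G → internalF G ≤ n → Expansion m (That G ∘ P)) → Expansion m (linComb L ∘ P)
Expansion-linComb []                  []            []            _         = Expansion-zero
Expansion-linComb ((c , w , G) ∷ L) (1≤w ∷ 1≤L) (G≤n ∷ L≤n) expand-That =
  Expansion-⊕ (Expansion-scale c (Expansion-Rs w 1≤w (expand-That G G≤n)))
              (Expansion-linComb L 1≤L L≤n expand-That)

Expansion-∘ : ∀ {n m O P} → Expansion n O → (∀ G → internalF G ≤ n → Expansion m (That G ∘ P)) →
              Expansion m (O ∘ P)
Expansion-∘ {P = P} E expand-That =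
  Expansion-cong (λ f → expands E (P f)) (Expansion-linComb (terms E) (positive E) (bounded E) expand-That)

-- That G ∘ T^{s₀}_{k+1} is the grove extractor of G with leaf k split, and the other flavour
-- of T_{k+1} differs from it by R_{k+2} − R_{k+1}.
That-T-expansion : ∀ G → (∀ j → 1 ≤ j → Expansion (internalF G) (That G ∘ R j)) →
                   ∀ s k → Expansion (suc (internalF G)) (That G ∘ Tˢ s (suc k))
That-T-expansion G R-expansion s k with s₀ , splitF≃ ← That-splitF G k (<-wellFounded (internalF G)) =
  Expansion-cong decompose
    (Expansion-⊕ split (Expansion-scale c (Expansion-⊖ (R-expansion′ (suc k)) (R-expansion′ k))))
  where
  c = χ s - χ s₀
  lin = That-linear G
  split : Expansion (suc (internalF G)) (That (splitF k G))
  split = subst (λ n → Expansion n (That (splitF k G))) (splitF-internal k G) (Expansion-That (splitF k G))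
  R-expansion′ : ∀ j → Expansion (suc (internalF G)) (That G ∘ R (suc j))
  R-expansion′ j = Expansion-weaken (ℕ.n≤1+n _) (R-expansion (suc j) (s≤s z≤n))
  decompose : ∀ f → That G (Tˢ s (suc k) f) ≃
                    That (splitF k G) f ⊕ scale c (That G (R (suc (suc k)) f) ⊖ That G (R (suc k) f))
  decompose f = begin
    That G (Tˢ s (suc k) f)
      ≈⟨ cong-≃ lin (Tˢ-change s s₀ (suc k) f) ⟩
    That G (Tˢ s₀ (suc k) f ⊕ scale c (R (suc (suc k)) f ⊖ R (suc k) f))
      ≈⟨ ⊕-hom lin (Tˢ s₀ (suc k) f) _ ⟩
    That G (Tˢ s₀ (suc k) f) ⊕ That G (scale c (R (suc (suc k)) f ⊖ R (suc k) f))
      ≈⟨ ⊕-cong (≃-sym (splitF≃ f))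
                (≃-trans (scale-hom lin c _) (scale-cong c (⊖-hom lin (R (suc (suc k)) f) (R (suc k) f)))) ⟩
    That (splitF k G) f ⊕ scale c (That G (R (suc (suc k)) f) ⊖ That G (R (suc k) f)) ∎
    where open ≃-Reasoning

That-R-expansion : ∀ F → Acc _<_ (internalF F) → ∀ j → 1 ≤ j → Expansion (internalF F) (That F ∘ R j)
That-R-expansion F _ j 1≤j with cherryF′ 0 F in cherry≡
... | nothing =
  Expansion-cong (λ f → ≃-reflexive (That-trivial F (cherryF′-nothing 0 F cherry≡) (R j f)))
                 (Expansion-weaken z≤n (Expansion-R 1≤j (Expansion-That [])))
... | just (zero , _ , _) with () ← cherryF′-index 0 F cherry≡
That-R-expansion F (acc smaller) (suc b) _ | just (suc a , s , F′) =
  Expansion-cong (λ f → ≃-reflexive (That-step F cherry≡ (R (suc b) f))) (exchange (ℕ.<-cmp b (suc a)))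
  where
  F′<F : internalF F′ < internalF F
  F′<F = ℕ.≤-reflexive (sym (cherryF′-internal 0 F cherry≡))
  lin = That-linear F′
  expand-R-T : ∀ j k → Expansion (internalF F) (That F′ ∘ R (suc j) ∘ Tˢ s (suc k))
  expand-R-T j k = Expansion-weaken F′<F
    (Expansion-∘ (That-R-expansion F′ (smaller F′<F) (suc j) (s≤s z≤n)) λ G G≤F′ →
      Expansion-weaken (s≤s G≤F′)
        (That-T-expansion G (That-R-expansion G (smaller (ℕ.≤-<-trans G≤F′ F′<F))) s k))
  exchange : Tri (b < suc a) (b ≡ suc a) (suc a < b) →
             Expansion (internalF F) (That F′ ∘ Tˢ s (suc a) ∘ R (suc b))
  exchange (tri< b<i _ _) =
    Expansion-cong (λ f → cong-≃ lin (T-R-near s (ℕ.≤-pred b<i) f)) (expand-R-T b (suc a))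
  exchange (tri≈ _ refl _) =
    Expansion-cong (λ f → ≃-trans (cong-≃ lin (T-R-adjacent s a f)) (⊕-hom lin _ _))
                   (Expansion-⊕ (expand-R-T a (suc a)) (expand-R-T (suc a) a))
  exchange (tri> _ _ i<b@(s≤s {n = c} _)) =
    Expansion-cong (λ f → cong-≃ lin (T-R-far s i<b f)) (expand-R-T c a)

ct-R : ∀ i p → ct (R i p) ≡ ct p
ct-R i p = trans (coeff-R i p []) (coeff-congʳ (eqMon-zeros (i ∸ 1)) p)

ct-Rs : ∀ w p → ct (Rs w p) ≡ ct p
ct-Rs []      p = refl
ct-Rs (j ∷ w) p = trans (ct-R j (Rs w p)) (ct-Rs w p)

ctTerms : List Term → List (ℤ × Forest)
ctTerms = map (Product.map₂ proj₂)

ct-linComb : ∀ L f → ct (linComb L f) ≡ ctComb (ctTerms L) f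
ct-linComb []                f = refl
ct-linComb ((c , w , G) ∷ L) f = begin
  ct (scale c (Rs w (That G f)) ⊕ linComb L f)
    ≡⟨ coeff-++ (scale c (Rs w (That G f))) (linComb L f) [] ⟩
  ct (scale c (Rs w (That G f))) + ct (linComb L f)
    ≡⟨ cong₂ _+_ (trans (coeff-scale c (Rs w (That G f)) []) (cong (c *_) (ct-Rs w (That G f))))
                 (ct-linComb L f) ⟩
  c * ct (That G f) + ctComb (ctTerms L) f ∎
  where open ≡-Reasoning

corollary4p4 : (F : Forest) (i : ℕ) → 1 ≤ i →
    (Σ (List (ℤ × List ℕ × Forest)) λ L →
        All (λ term → All (λ j → 1 ≤ j) (proj₁ (proj₂ term))) L
        × (∀ (f : Poly) → That F (R i f) ≈ linComb L f))
    × (Σ (List (ℤ × Forest)) λ L′ →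
        ∀ (f : Poly) → ct (That F (R i f)) ≡ ctComb L′ f)
corollary4p4 F i 1≤i =
  (terms E , positive E , coeff-≡ ∘ expands E) ,
  (ctTerms (terms E) , λ f → trans (coeff-≡ (expands E f) []) (ct-linComb (terms E) f))
  where
  E : Expansion (internalF F) (That F ∘ R i)
  E = That-R-expansion F (<-wellFounded (internalF F)) i 1≤i
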